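{- Let $S$ be a finite set with $|S|\ge2$, and let the partition of $S$ be chosen uniformly at random among the partitions of $S$ with exactly two blocks. Then the expected number of productive queries made by any AC algorithm is exactly \[ \frac{2^{|S|}}{2^{|S|}-2}\cdot\frac{|S|-1}{2}. \]
   Context: AC algorithm: on a finite set $S$ with an unknown set partition $P$, it adaptively asks an oracle whether two items are in the same block. Aggregated graphs: $G_0$ is the edgeless graph on $S$; each query concerns two distinct non-adjacent vertices $x,y$ of the current aggregated graph $G_t$; a negative answer adds the edge $xy$; a positive answer merges $x,y$ into one vertex adjacent to all their neighbours, labelled by the union of their labels. The algorithm stops when the aggregated graph is complete. A query is core if it receives a positive answer; it is excessive if $x$ and $y$ are joined in $G_t$ by an induced path with an even number of vertices alternating between two blocks of $P$; it is productive if it is neither core nor excessive. -}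

module Defs where

open import Data.Nat using (ℕ; zero; suc; _+_; _≤_)
open import Data.Nat.Divisibility using (_∣_)
open import Data.Bool using (Bool; true; false; if_then_else_)
import Data.Bool.Properties as BoolP
open import Data.Fin using (Fin; zero; suc; toℕ; _≟_)
open import Data.Fin.Properties using (any?)
open import Data.Product using (Σ; ∃; ∃₂; _×_; _,_)
open import Data.Sum using (_⊎_)
open import Data.List using (List; []; _∷_; _++_; [_]; foldl; length; lookup; concatMap; filter)
open import Data.List.Relation.Unary.All using (All)
open import Data.List.Relation.Unary.Any using (Any)
open import Data.List.Relation.Unary.Linked using (Linked)
open import Data.List.Relation.Unary.Unique.Propositional using (Unique)
open import Relation.Nullary using (¬_; Dec; does; ¬?)
open import Relation.Binary.PropositionalEquality using (_≡_; _≢_)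
open import Function using (id)

-- The ground set S is Fin n.  A partition of S into (at most) two blocks is
-- represented by a 2-colouring; it has exactly two blocks iff it is non-constant.
Coloring : ℕ → Set
Coloring n = Fin n → Bool

NonConstant : ∀ {n} → Coloring n → Set
NonConstant {n} c = ∃₂ λ (i j : Fin n) → c i ≢ c j

nonConstant? : ∀ {n} (c : Coloring n) → Dec (NonConstant c)
nonConstant? c = any? (λ i → any? (λ j → ¬? (c i BoolP.≟ c j)))

consC : ∀ {n} → Bool → Coloring n → Coloring (suc n)
consC b f zero    = b
consC b f (suc i) = f i

allColorings : (n : ℕ) → List (Coloring n)
allColorings zero    = (λ ()) ∷ []
allColorings (suc n) = concatMap (λ f → consC false f ∷ consC true f ∷ []) (allColorings n)

-- colourings inducing a partition with exactly two blocks
-- (every 2-block partition arises from exactly two of them)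
twoBlockColorings : (n : ℕ) → List (Coloring n)
twoBlockColorings n = filter nonConstant? (allColorings n)

record Step (n : ℕ) : Set where
  constructor mkStep
  field
    qx qy : Fin n
    ans   : Bool

History : ℕ → Set
History n = List (Step n)

-- Aggregated graph: each item i lies in the vertex represented by item (rep i);
-- vertices are the items u with rep u ≡ u (the label of u is {i | rep i ≡ u}).
-- negs records the negative answers; vertices u v are adjacent iff some
-- negatively answered pair has its endpoints (now) in u and v.
record AGraph (n : ℕ) : Set where
  constructor mkG
  field
    rep  : Fin n → Fin n
    negs : List (Fin n × Fin n)
open AGraph public

initG : ∀ {n} → AGraph n
initG = mkG id []

applyStep : ∀ {n} → AGraph n → Step n → AGraph n
applyStep (mkG r ns) (mkStep x y true)  = mkG (λ i → if does (r i ≟ y) then x else r i) ns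
applyStep (mkG r ns) (mkStep x y false) = mkG r ((x , y) ∷ ns)

graphOf : ∀ {n} → History n → AGraph n
graphOf = foldl applyStep initG

IsVertex : ∀ {n} → AGraph n → Fin n → Set
IsVertex G u = rep G u ≡ u

Adj : ∀ {n} → AGraph n → Fin n → Fin n → Set
Adj G u v = Any (λ e → (rep G (Data.Product.proj₁ e) ≡ u × rep G (Data.Product.proj₂ e) ≡ v)
                     ⊎ (rep G (Data.Product.proj₁ e) ≡ v × rep G (Data.Product.proj₂ e) ≡ u))
                (negs G)

Complete : ∀ {n} → AGraph n → Set
Complete {n} G = ∀ (u v : Fin n) → IsVertex G u → IsVertex G v → u ≢ v → Adj G u v

ValidQuery : ∀ {n} → AGraph n → Fin n × Fin n → Set
ValidQuery G (x , y) = IsVertex G x × IsVertex G y × x ≢ y × ¬ Adj G x y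

-- An AC algorithm: an adaptive strategy choosing the next query from the
-- history of previous queries and answers; it must make a legal query
-- whenever the aggregated graph is not complete (and it stops when it is).
record ACAlgorithm (n : ℕ) : Set where
  field
    next  : History n → Fin n × Fin n
    valid : ∀ h → ¬ Complete (graphOf h) → ValidQuery (graphOf h) (next h)
open ACAlgorithm public

answer : ∀ {n} → Coloring n → Fin n → Fin n → Bool
answer c x y = does (c x BoolP.≟ c y)

stepOf : ∀ {n} → Coloring n → Fin n × Fin n → Step n
stepOf c (x , y) = mkStep x y (answer c x y)

InducedAltPath : ∀ {n} → AGraph n → Coloring n → Fin n → Fin n → List (Fin n) → Set
InducedAltPath G c x y ps =
  (∃ λ mid → ps ≡ x ∷ (mid ++ [ y ]))
  × All (IsVertex G) ps
  × Unique ps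
  × Linked (Adj G) ps
  × (∀ (i j : Fin (length ps)) → 2 + toℕ i ≤ toℕ j → ¬ Adj G (lookup ps i) (lookup ps j))
  × Linked (λ a b → c a ≢ c b) ps
  × (2 ∣ length ps)

Excessive : ∀ {n} → AGraph n → Coloring n → Fin n → Fin n → Set
Excessive G c x y = ∃ λ ps → InducedAltPath G c x y ps

Core : ∀ {n} → Coloring n → Fin n × Fin n → Set
Core c (x , y) = answer c x y ≡ true

Productive : ∀ {n} → AGraph n → Coloring n → Fin n × Fin n → Set
Productive G c (x , y) = ¬ Core c (x , y) × ¬ Excessive G c x y

data RunCount {n : ℕ} (A : ACAlgorithm n) (c : Coloring n) : History n → ℕ → Set where
  done    : ∀ {h} → Complete (graphOf h) → RunCount A c h 0
  prod    : ∀ {h k} → ¬ Complete (graphOf h) → Productive (graphOf h) c (next A h)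
          → RunCount A c (h ++ [ stepOf c (next A h) ]) k → RunCount A c h (suc k)
  nonprod : ∀ {h k} → ¬ Complete (graphOf h) → ¬ Productive (graphOf h) c (next A h)
          → RunCount A c (h ++ [ stepOf c (next A h) ]) k → RunCount A c h k

ProductiveCount : ∀ {n} → ACAlgorithm n → Coloring n → ℕ → Set
ProductiveCount A c k = RunCount A c [] k

{-# OPTIONS --safe #-}
module Submission where

-- A query is productive exactly when it is answered negatively and joins two different components
-- of the graph of all queries asked so far: inside a component the aggregated graph has a walk
-- between the two vertices, which shortens to an induced path, and the colouring forces its colours
-- to alternate, so a negatively answered query there is excessive.  Every run makes n - 1 joining
-- queries.  Recolouring the whole component of y is a bijection between the colourings consistent
-- with the history so far that answer a joining query positively and those that answer it
-- negatively, so over the decision tree of the algorithm 2 S + C = m C, where C colourings are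
-- consistent with a history whose query graph has m components and S is the number of productive
-- queries they still cause.  At the root this gives that the 2^n colourings make (n - 1) 2^(n-1)
-- productive queries in total, all of them from the 2^n - 2 non-constant ones.

open import Data.Nat using (ℕ; zero; suc; _+_; _*_; _∸_; _^_; _≤_; _<_; z≤n; s≤s)
open import Data.Nat.Properties using (+-mono-≤; +-mono-<-≤; +-mono-≤-<; <-≤-trans; ≤-pred; +-identityʳ; +-comm; +-assoc; *-distribˡ-+; +-cancelˡ-≡; m+n∸n≡m; n<1+n; +-0-commutativeMonoid; +-commutativeSemigroup)
open import Data.Nat.Solver using (module +-*-Solver)
open +-*-Solver using (solve; _:+_; _:*_; _:=_; con)
open import Data.Nat.Divisibility using (_∣_; ∣-refl; ∣m∣n⇒∣m+n)
open import Data.Bool using (Bool; true; false; not; _∧_; _xor_; if_then_else_)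
import Data.Bool.Properties as Bool
open import Data.Fin using (Fin; toℕ) renaming (zero to fzero; suc to fsuc)
import Data.Fin as Fin
open import Data.Fin.Properties using (all?)
open import Data.Maybe using (just)
open import Data.Maybe.Properties using (just-injective)
open import Data.List using (List; []; _∷_; _++_; [_]; length; lookup; drop; last; foldl; map; filter; concatMap)
open import Data.List.Properties using (foldl-++; map-cong)
open import Data.Nat.ListAction using (sum)
open import Data.Bool.ListAction using (all)
open import Data.List.Relation.Unary.All as All using (All; []; _∷_)
open import Data.List.Relation.Unary.All.Properties using (¬Any⇒All¬; ++⁺)
open import Data.List.Relation.Unary.Any as Any using (Any; here; there)
open import Data.List.Relation.Unary.Linked as Linked using (Linked; []; [-]; _∷_)
open import Data.List.Relation.Unary.Unique.Propositional using (Unique)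
open import Data.List.Relation.Unary.AllPairs as AllPairs using ([]; _∷_)
open import Data.List.Membership.Propositional using (_∈_; _∉_)
open import Data.List.Membership.Propositional.Properties using (∈-lookup; ∈-++⁺ʳ)
import Data.List.Membership.DecPropositional as DecMembership
open import Data.Product using (Σ; ∃; _×_; _,_; proj₁; proj₂)
open import Data.Unit using (⊤; tt)
open import Data.Empty using (⊥-elim)
open import Data.Sum using (inj₁; inj₂)
open import Function using (id)
open import Relation.Nullary using (¬_; Dec; yes; no; does; ¬?)
open import Relation.Nullary.Decidable using (_×-dec_; _⊎-dec_; _→-dec_; dec-true; dec-false; decidable-stable)
open import Relation.Nullary.Reflects using (Reflects; ofʸ; ofⁿ)
open import Relation.Binary.Definitions using (DecidableEquality)
open import Relation.Binary.Construct.Closure.ReflexiveTransitive using (Star; ε; _◅_; _◅◅_; gmap; reverse)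
open import Relation.Binary.PropositionalEquality using (_≡_; _≢_; refl; sym; trans; cong; cong₂; subst; subst₂; module ≡-Reasoning)

open import Algebra.Properties.CommutativeSemigroup +-commutativeSemigroup using () renaming (interchange to +-interchange)
open import Algebra.Properties.CommutativeMonoid.Sum +-0-commutativeMonoid using (sum-syntax; sum-cong-≗; sum-replicate-zero) renaming (sum to ∑)

open import Defs

private variable n : ℕ

bit : Bool → ℕ
bit b = if b then 1 else 0

bit-mono : ∀ {P Q : Set} (p : Dec P) (q : Dec Q) → (P → Q) → bit (does p) ≤ bit (does q)
bit-mono (yes p) (yes q) _   = s≤s z≤n
bit-mono (yes p) (no ¬q) p→q = ⊥-elim (¬q (p→q p))
bit-mono (no ¬p) q       _   = z≤n

bit-mono-< : ∀ {P Q : Set} (p : Dec P) (q : Dec Q) → ¬ P → Q → bit (does p) < bit (does q)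
bit-mono-< (yes p) q       ¬p _ = ⊥-elim (¬p p)
bit-mono-< (no ¬p) (yes q) _  _ = s≤s z≤n
bit-mono-< (no ¬p) (no ¬q) _  q = ⊥-elim (¬q q)

∑-mono : ∀ {m} {f g : Fin m → ℕ} → (∀ i → f i ≤ g i) → ∑ f ≤ ∑ g
∑-mono {zero}  f≤g = z≤n
∑-mono {suc m} f≤g = +-mono-≤ (f≤g fzero) (∑-mono (λ i → f≤g (fsuc i)))

∑-mono-< : ∀ {m} {f g : Fin m → ℕ} → (∀ i → f i ≤ g i) → ∀ e → f e < g e → ∑ f < ∑ g
∑-mono-< {suc m} f≤g fzero    f<g = +-mono-<-≤ f<g (∑-mono (λ i → f≤g (fsuc i)))
∑-mono-< {suc m} f≤g (fsuc e) f<g = +-mono-≤-< (f≤g fzero) (∑-mono-< (λ i → f≤g (fsuc i)) e f<g)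

bit-cong : ∀ {P Q : Set} (p : Dec P) (q : Dec Q) → (P → Q) → (Q → P) → bit (does p) ≡ bit (does q)
bit-cong (yes p) q       p→q _   = cong bit (sym (dec-true q (p→q p)))
bit-cong (no ¬p) q       _   q→p = cong bit (sym (dec-false q (λ q → ¬p (q→p q))))

∑-+ : ∀ {m} (f g : Fin m → ℕ) → ∑ (λ i → f i + g i) ≡ ∑ f + ∑ g
∑-+ {zero}  f g = refl
∑-+ {suc m} f g = trans (cong (f fzero + g fzero +_) (∑-+ (λ i → f (fsuc i)) (λ i → g (fsuc i)))) (+-interchange (f fzero) (g fzero) _ _)

∑-one : ∀ m → ∑[ i < m ] 1 ≡ m
∑-one zero    = refl
∑-one (suc m) = cong suc (∑-one m)

∑-indicator : ∀ {m} (k : Fin m) → ∑[ i < m ] bit (does (i Fin.≟ k)) ≡ 1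
∑-indicator {suc m} fzero    = cong suc (sum-replicate-zero m)
∑-indicator {suc m} (fsuc k) = ∑-indicator k

when : Bool → ℕ → ℕ
when b k = if b then k else 0

when-zero : ∀ b → when b 0 ≡ 0
when-zero false = refl
when-zero true  = refl

when-+ : ∀ b k l → when b (k + l) ≡ when b k + when b l
when-+ false k l = refl
when-+ true  k l = refl

bit-∧-split : ∀ ch a → bit ch ≡ bit (ch ∧ does (true Bool.≟ a)) + bit (ch ∧ does (false Bool.≟ a))
bit-∧-split false a     = refl
bit-∧-split true  false = refl
bit-∧-split true  true  = refl

when-split : ∀ ch a p (t f : ℕ) → when ch (bit (not a ∧ p) + (if a then t else f))
             ≡ when (ch ∧ does (true Bool.≟ a)) t + when (ch ∧ does (false Bool.≟ a)) (f + bit p)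
when-split false a     p t f = refl
when-split true  true  p t f = sym (+-identityʳ t)
when-split true  false p t f = +-comm (bit p) f

if-same : ∀ (F : Bool → ℕ) a → F a ≡ (if a then F true else F false)
if-same F false = refl
if-same F true  = refl

total : ∀ {B : Set} → (B → ℕ) → List B → ℕ
total g L = sum (map g L)

module _ {B : Set} where
  total-cong : ∀ {g g′ : B → ℕ} L → (∀ c → g c ≡ g′ c) → total g L ≡ total g′ L
  total-cong L eq = cong sum (map-cong eq L)

  total-+ : ∀ (g g′ : B → ℕ) L → total (λ c → g c + g′ c) L ≡ total g L + total g′ L
  total-+ g g′ []      = refl
  total-+ g g′ (c ∷ L) = trans (cong (g c + g′ c +_) (total-+ g g′ L)) (+-interchange (g c) (g′ c) _ _)

  total-zero : ∀ (L : List B) → total (λ _ → 0) L ≡ 0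
  total-zero []      = refl
  total-zero (_ ∷ L) = total-zero L

  total-filter : ∀ {P : B → Set} (P? : ∀ c → Dec (P c)) g L →
                 total g (filter P? L) ≡ total (λ c → if does (P? c) then g c else 0) L
  total-filter P? g []      = refl
  total-filter P? g (c ∷ L) with does (P? c)
  ... | true  = cong (g c +_) (total-filter P? g L)
  ... | false = total-filter P? g L

  length-filter : ∀ {P : B → Set} (P? : ∀ c → Dec (P c)) L → length (filter P? L) ≡ total (λ c → bit (does (P? c))) L
  length-filter P? []      = refl
  length-filter P? (c ∷ L) with does (P? c)
  ... | true  = cong suc (length-filter P? L)
  ... | false = length-filter P? L

∑ᶜ : ∀ n → (Coloring n → ℕ) → ℕ
∑ᶜ n g = total g (allColorings n)

∑ᶜ-suc : ∀ n g → ∑ᶜ (suc n) g ≡ ∑ᶜ n (λ f → g (consC false f) + g (consC true f))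
∑ᶜ-suc n g = pairs (allColorings n)
  where
    pairs : ∀ L → total g (concatMap (λ f → consC false f ∷ consC true f ∷ []) L) ≡ total (λ f → g (consC false f) + g (consC true f)) L
    pairs []      = refl
    pairs (f ∷ L) = trans (sym (+-assoc (g (consC false f)) _ _)) (cong (g (consC false f) + g (consC true f) +_) (pairs L))

∑ᶜ-one : ∀ n → ∑ᶜ n (λ _ → 1) ≡ 2 ^ n
∑ᶜ-one zero    = refl
∑ᶜ-one (suc n) = trans (∑ᶜ-suc n _) (trans (total-+ _ _ (allColorings n)) (cong₂ _+_ (∑ᶜ-one n) (trans (∑ᶜ-one n) (sym (+-identityʳ _)))))

Extensional : ∀ {n} → (Coloring n → ℕ) → Set
Extensional g = ∀ {c c′} → (∀ i → c i ≡ c′ i) → g c ≡ g c′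

flipOn : (Fin n → Bool) → Coloring n → Coloring n
flipOn K c i = K i xor c i

∑ᶜ-flipOn : ∀ n (K : Fin n → Bool) g → Extensional g → ∑ᶜ n g ≡ ∑ᶜ n (λ c → g (flipOn K c))
∑ᶜ-flipOn zero    K g ext = cong (_+ 0) (ext (λ ()))
∑ᶜ-flipOn (suc n) K g ext = begin
  ∑ᶜ (suc n) g                                   ≡⟨ ∑ᶜ-suc n g ⟩
  ∑ᶜ n pair                                      ≡⟨ ∑ᶜ-flipOn n K′ pair pair-ext ⟩
  ∑ᶜ n (λ f → pair (flipOn K′ f))                ≡⟨ total-cong (allColorings n) flipped-pair ⟩
  ∑ᶜ n (λ f → g (flipOn K (consC false f)) + g (flipOn K (consC true f))) ≡⟨ ∑ᶜ-suc n (λ c → g (flipOn K c)) ⟨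
  ∑ᶜ (suc n) (λ c → g (flipOn K c))              ∎
  where
    open ≡-Reasoning
    K′ : Fin n → Bool
    K′ i = K (fsuc i)
    pair : Coloring n → ℕ
    pair f = g (consC false f) + g (consC true f)
    consC-cong : ∀ b {f f′ : Coloring n} → (∀ i → f i ≡ f′ i) → ∀ i → consC b f i ≡ consC b f′ i
    consC-cong b eq fzero    = refl
    consC-cong b eq (fsuc i) = eq i
    pair-ext : Extensional pair
    pair-ext eq = cong₂ _+_ (ext (consC-cong false eq)) (ext (consC-cong true eq))
    flipOn-consC : ∀ b f → g (flipOn K (consC b f)) ≡ g (consC (K fzero xor b) (flipOn K′ f))
    flipOn-consC b f = ext λ { fzero → refl ; (fsuc i) → refl }
    flipped-pair : ∀ f → pair (flipOn K′ f) ≡ g (flipOn K (consC false f)) + g (flipOn K (consC true f))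
    flipped-pair f rewrite flipOn-consC false f | flipOn-consC true f with K fzero
    ... | false = refl
    ... | true  = +-comm (g (consC false (flipOn K′ f))) _

constant? : ∀ {n} (b : Bool) (c : Coloring n) → Dec (∀ i → c i ≡ b)
constant? b c = all? λ i → c i Bool.≟ b

constant-consC-same : ∀ {n} b (f : Coloring n) → bit (does (constant? b (consC b f))) ≡ bit (does (constant? b f))
constant-consC-same b f = bit-cong (constant? b (consC b f)) (constant? b f) (λ k i → k (fsuc i)) λ { k fzero → refl ; k (fsuc i) → k i }

constant-consC-other : ∀ {n} b (f : Coloring n) → bit (does (constant? b (consC (not b) f))) ≡ 0
constant-consC-other b f = cong bit (dec-false (constant? b (consC (not b) f)) λ k → Bool.not-¬ refl (sym (k fzero)))

∑ᶜ-constant : ∀ n b → ∑ᶜ n (λ c → bit (does (constant? b c))) ≡ 1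
∑ᶜ-constant zero    b     = cong (λ d → bit d + 0) (dec-true (constant? {0} b (λ ())) (λ ()))
∑ᶜ-constant (suc n) false = trans (∑ᶜ-suc n _) (trans (total-cong (allColorings n) λ f →
  trans (cong₂ _+_ (constant-consC-same false f) (constant-consC-other false f)) (+-identityʳ _)) (∑ᶜ-constant n false))
∑ᶜ-constant (suc n) true  = trans (∑ᶜ-suc n _) (trans (total-cong (allColorings n) λ f →
  cong₂ _+_ (constant-consC-other true f) (constant-consC-same true f)) (∑ᶜ-constant n true))

nonConstant-or-constant : ∀ {n} (c : Coloring (suc n)) →
  bit (does (nonConstant? c)) + (bit (does (constant? false c)) + bit (does (constant? true c))) ≡ 1
nonConstant-or-constant c = by-cases (nonConstant? c)
  where
    not-constant : ∀ b → c fzero ≡ b → does (constant? (not b) c) ≡ false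
    not-constant b c0≡b = dec-false (constant? (not b) c) λ k → Bool.not-¬ refl (trans (sym c0≡b) (k fzero))
    constant-at : (∀ i → c i ≡ c fzero) → ∀ b → c fzero ≡ b → bit (does (constant? false c)) + bit (does (constant? true c)) ≡ 1
    constant-at k false c0≡b = cong₂ (λ p q → bit p + bit q) (dec-true (constant? false c) (λ i → trans (k i) c0≡b)) (not-constant false c0≡b)
    constant-at k true  c0≡b = cong₂ (λ p q → bit p + bit q) (not-constant true c0≡b) (dec-true (constant? true c) (λ i → trans (k i) c0≡b))
    by-cases : (d : Dec (NonConstant c)) → bit (does d) + (bit (does (constant? false c)) + bit (does (constant? true c))) ≡ 1
    by-cases (yes (i , j , ci≢cj)) = cong₂ (λ p q → 1 + (bit p + bit q)) (apart false) (apart true)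
      where apart : ∀ b → does (constant? b c) ≡ false
            apart b = dec-false (constant? b c) λ k → ci≢cj (trans (k i) (sym (k j)))
    by-cases (no ¬nonConstant) = constant-at (λ i → decidable-stable (c i Bool.≟ c fzero) λ ci≢c0 → ¬nonConstant (i , fzero , ci≢c0)) (c fzero) refl

∑ᶜ-nonConstant : ∀ n → ∑ᶜ (suc n) (λ c → bit (does (nonConstant? c))) + 2 ≡ 2 ^ suc n
∑ᶜ-nonConstant n = begin
  T + 2                                   ≡⟨ cong (T +_) (cong₂ _+_ (∑ᶜ-constant (suc n) false) (∑ᶜ-constant (suc n) true)) ⟨
  T + (∑ᶜ (suc n) cf + ∑ᶜ (suc n) ct)     ≡⟨ cong (T +_) (total-+ cf ct (allColorings (suc n))) ⟨
  T + ∑ᶜ (suc n) (λ c → cf c + ct c)      ≡⟨ total-+ _ _ (allColorings (suc n)) ⟨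
  ∑ᶜ (suc n) (λ c → bit (does (nonConstant? c)) + (cf c + ct c)) ≡⟨ total-cong (allColorings (suc n)) nonConstant-or-constant ⟩
  ∑ᶜ (suc n) (λ _ → 1)                    ≡⟨ ∑ᶜ-one (suc n) ⟩
  2 ^ suc n                               ∎
  where
    open ≡-Reasoning
    T : ℕ
    T = ∑ᶜ (suc n) (λ c → bit (does (nonConstant? c)))
    cf ct : Coloring (suc n) → ℕ
    cf c = bit (does (constant? false c))
    ct c = bit (does (constant? true c))

twoBlockColorings-length : ∀ n → length (twoBlockColorings (suc n)) ≡ 2 ^ suc n ∸ 2
twoBlockColorings-length n = trans (length-filter nonConstant? (allColorings (suc n)))
  (sym (trans (cong (_∸ 2) (sym (∑ᶜ-nonConstant n))) (m+n∸n≡m _ 2)))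

sum-twoBlockColorings : ∀ n (k : Coloring n → ℕ) → (∀ c → ¬ NonConstant c → k c ≡ 0) →
                        sum (map k (twoBlockColorings n)) ≡ ∑ᶜ n k
sum-twoBlockColorings n k vanish = trans (total-filter nonConstant? k (allColorings n)) (total-cong (allColorings n) λ c → on (nonConstant? c))
  where on : ∀ {c} (d : Dec (NonConstant c)) → (if does d then k c else 0) ≡ k c
        on (yes _)               = refl
        on {c} (no ¬nonConstant) = sym (vanish c ¬nonConstant)

-- Induced paths

module InducedPaths {A : Set} (_≟_ : DecidableEquality A)
                    (R : A → A → Set) (R? : ∀ a b → Dec (R a b)) where
  open DecMembership _≟_ using (_∈?_)

  Induced : List A → Set
  Induced []      = ⊤
  Induced (a ∷ l) = All (λ z → ¬ R a z) (drop 1 l) × Induced l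

  record IsInducedPath (y : A) (ps : List A) : Set where
    field
      endsAt  : last ps ≡ just y
      linked  : Linked R ps
      induced : Induced ps
      unique  : Unique ps
  open IsInducedPath

  pathTail : ∀ {y b c t} → IsInducedPath y (b ∷ c ∷ t) → IsInducedPath y (c ∷ t)
  pathTail p = record { endsAt  = endsAt p
                      ; linked  = Linked.tail (linked p)
                      ; induced = proj₂ (induced p)
                      ; unique  = AllPairs.tail (unique p) }

  pathFrom : ∀ {y a ps} → a ∈ ps → IsInducedPath y ps → ∃ λ t → IsInducedPath y (a ∷ t)
  pathFrom {ps = _ ∷ t}     (here refl) p = t , p
  pathFrom {ps = _ ∷ _ ∷ _} (there a∈)  p = pathFrom a∈ (pathTail p)

  -- Jump from a straight to the last vertex of the path adjacent to a.
  pathVia : ∀ {y a ps} → a ∉ ps → Any (R a) ps → IsInducedPath y ps → ∃ λ t → IsInducedPath y (a ∷ t)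
  pathVia {a = a} {ps = b ∷ t} a∉ adj p with Any.any? (R? a) t
  pathVia {ps = b ∷ c ∷ t} a∉ adj p | yes later = pathVia (λ a∈ → a∉ (there a∈)) later (pathTail p)
  ... | no notLater = b ∷ t , record
    { endsAt  = endsAt p
    ; linked  = headAdj adj ∷ linked p
    ; induced = ¬Any⇒All¬ t notLater , induced p
    ; unique  = ¬Any⇒All¬ (b ∷ t) a∉ ∷ unique p }
    where headAdj : Any (R _) (b ∷ t) → R _ b
          headAdj (here r)    = r
          headAdj (there adj) = ⊥-elim (notLater adj)

  inducedPath : ∀ {x y} → Star R x y → ∃ λ t → IsInducedPath y (x ∷ t)
  inducedPath ε = [] , record { endsAt = refl ; linked = [-] ; induced = [] , tt ; unique = [] ∷ [] }
  inducedPath {x} (r ◅ w) with inducedPath w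
  ... | t , p with x ∈? (_ ∷ t)
  ...   | yes x∈ = pathFrom x∈ p
  ...   | no x∉  = pathVia x∉ (here r) p

  induced⇒lookup : ∀ ps → Induced ps → ∀ (i j : Fin (length ps)) → 2 + toℕ i ≤ toℕ j → ¬ R (lookup ps i) (lookup ps j)
  induced⇒lookup (a ∷ b ∷ l) (far , _) fzero (fsuc (fsuc j)) _ = All.lookup far (∈-lookup {xs = l} j)
  induced⇒lookup (a ∷ b ∷ l) _          fzero (fsuc fzero) (s≤s ())
  induced⇒lookup (a ∷ l) (_ , ind) (fsuc i) (fsuc j) (s≤s le) = induced⇒lookup l ind i j le

alternating-even : ∀ {A : Set} (col : A → Bool) {x y} t →
  Linked (λ a b → col a ≢ col b) (x ∷ t) → last (x ∷ t) ≡ just y → col x ≢ col y → 2 ∣ length (x ∷ t)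
alternating-even col []          _              end x≢y = ⊥-elim (x≢y (cong col (just-injective end)))
alternating-even col (b ∷ [])    _              _   _   = ∣-refl
alternating-even col (b ∷ c ∷ t) (xb ∷ bc ∷ l) end x≢y =
  ∣m∣n⇒∣m+n (∣-refl {2}) (alternating-even col t l end (λ c≡y → x≢y (trans x≡c c≡y)))
  where x≡c : col _ ≡ col c
        x≡c = trans (Bool.¬-not xb) (sym (Bool.¬-not (λ e → bc (sym e))))

last-snoc : ∀ {A : Set} {x y : A} t → last (x ∷ t) ≡ just y → ∃ λ init → x ∷ t ≡ init ++ [ y ]
last-snoc []      end = [] , cong [_] (just-injective end)
last-snoc {x = x} (c ∷ t) end with last-snoc t end
... | init , eq = x ∷ init , cong (x ∷_) eq

last-distinct : ∀ {A : Set} {x y : A} t → last (x ∷ t) ≡ just y → x ≢ y → ∃ λ mid → x ∷ t ≡ x ∷ (mid ++ [ y ])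
last-distinct t end x≢y with last-snoc t end
... | [] , refl = ⊥-elim (x≢y refl)
... | _ ∷ mid , refl = mid , refl

-- Components of the query graph

redirect : Fin n → Fin n → Fin n → Fin n
redirect x y w = if does (w Fin.≟ y) then x else w

redirect-joined : ∀ {x y w : Fin n} → w ≡ y → redirect x y w ≡ x
redirect-joined {y = y} refl with y Fin.≟ y
... | yes _  = refl
... | no y≢y = ⊥-elim (y≢y refl)

redirect-other : ∀ {x y w : Fin n} → w ≢ y → redirect x y w ≡ w
redirect-other {y = y} {w} w≢y with w Fin.≟ y
... | yes w≡y = ⊥-elim (w≢y w≡y)
... | no _    = refl

union : (Fin n → Fin n) → Fin n → Fin n → Fin n → Fin n
union cp x y i = redirect (cp x) (cp y) (cp i)

union-cong : ∀ (cp : Fin n → Fin n) x y {i j} → cp i ≡ cp j → union cp x y i ≡ union cp x y j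
union-cong cp x y = cong (redirect (cp x) (cp y))

union-source : ∀ (cp : Fin n → Fin n) x y → union cp x y x ≡ cp x
union-source cp x y with cp x Fin.≟ cp y
... | yes _ = refl
... | no _  = refl

union-idem : ∀ (cp : Fin n → Fin n) x y → (∀ i → cp (cp i) ≡ cp i) → ∀ i → union cp x y (union cp x y i) ≡ union cp x y i
union-idem cp x y idem i = by-cases (cp i Fin.≟ cp y)
  where
    by-cases : Dec (cp i ≡ cp y) → union cp x y (union cp x y i) ≡ union cp x y i
    by-cases (yes iy) = trans (cong (union cp x y) (redirect-joined iy))
                          (trans (union-cong cp x y (idem x)) (trans (union-source cp x y) (sym (redirect-joined iy))))
    by-cases (no iy)  = trans (cong (union cp x y) (redirect-other iy)) (union-cong cp x y (idem i))

components : History n → Fin n → Fin n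
components = foldl (λ cp s → union cp (Step.qx s) (Step.qy s)) id

adj-sym : ∀ {G : AGraph n} {u v} → Adj G u v → Adj G v u
adj-sym = Any.map λ { (inj₁ (p , q)) → inj₂ (p , q) ; (inj₂ (p , q)) → inj₁ (p , q) }

adj-merge : ∀ {r : Fin n → Fin n} {ns} x y {u v} →
            Adj (mkG r ns) u v → Adj (applyStep (mkG r ns) (mkStep x y true)) (redirect x y u) (redirect x y v)
adj-merge x y = Any.map λ { (inj₁ (p , q)) → inj₁ (cong (redirect x y) p , cong (redirect x y) q)
                          ; (inj₂ (p , q)) → inj₂ (cong (redirect x y) p , cong (redirect x y) q) }

Connected : AGraph n → (Fin n → Fin n) → Set
Connected G cp = ∀ i j → cp i ≡ cp j → Star (Adj G) (rep G i) (rep G j)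

connected-union : ∀ {G G′ : AGraph n} {cp} (f : Fin n → Fin n) {x y} →
  (∀ i → rep G′ i ≡ f (rep G i)) → (∀ {u v} → Adj G u v → Adj G′ (f u) (f v)) →
  Star (Adj G′) (rep G′ x) (rep G′ y) → Connected G cp → Connected G′ (union cp x y)
connected-union {G = G} {G′} {cp} f {x} {y} rep′ adj link conn i j eq = walk (cp i Fin.≟ cp y) (cp j Fin.≟ cp y)
  where
    lift : ∀ a b → cp a ≡ cp b → Star (Adj G′) (rep G′ a) (rep G′ b)
    lift a b e = subst₂ (Star (Adj G′)) (sym (rep′ a)) (sym (rep′ b)) (gmap f adj (conn a b e))
    walk : Dec (cp i ≡ cp y) → Dec (cp j ≡ cp y) → Star (Adj G′) (rep G′ i) (rep G′ j)
    walk (yes iy) (yes jy) = lift i j (trans iy (sym jy))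
    walk (yes iy) (no jy)  = lift i y iy ◅◅ reverse adj-sym link ◅◅ lift x j (trans (sym (redirect-joined iy)) (trans eq (redirect-other jy)))
    walk (no iy)  (yes jy) = lift i x (trans (sym (redirect-other iy)) (trans eq (redirect-joined jy))) ◅◅ link ◅◅ lift y j (sym jy)
    walk (no iy)  (no jy)  = lift i j (trans (sym (redirect-other iy)) (trans eq (redirect-other jy)))

-- cp sends each item to a representative of its component in the graph of all queries asked so far,
-- whatever their answers.
record ComponentMap (G : AGraph n) (cp : Fin n → Fin n) : Set where
  field
    rep-idem    : ∀ i → rep G (rep G i) ≡ rep G i
    cp-idem     : ∀ i → cp (cp i) ≡ cp i
    cp-rep      : ∀ i → cp (rep G i) ≡ cp i
    negs-within : All (λ e → cp (proj₁ e) ≡ cp (proj₂ e)) (negs G)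
    connected   : Connected G cp
open ComponentMap

componentMap-init : ComponentMap (initG {n}) id
componentMap-init = record
  { rep-idem = λ _ → refl ; cp-idem = λ _ → refl ; cp-rep = λ _ → refl ; negs-within = []
  ; connected = λ { i .i refl → ε } }

module _ {r : Fin n → Fin n} {ns : List (Fin n × Fin n)} {cp : Fin n → Fin n} {x y : Fin n}
         (vq : ValidQuery (mkG r ns) (x , y)) (inv : ComponentMap (mkG r ns) cp) where
  private
    x-vertex : r x ≡ x
    x-vertex = proj₁ vq
    y-vertex : r y ≡ y
    y-vertex = proj₁ (proj₂ vq)
    x≢y : x ≢ y
    x≢y = proj₁ (proj₂ (proj₂ vq))

  componentMap-merge : ComponentMap (applyStep (mkG r ns) (mkStep x y true)) (union cp x y)
  componentMap-merge = record
    { rep-idem    = λ i → merged-idem i (r i Fin.≟ y)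
    ; cp-idem     = union-idem cp x y (cp-idem inv)
    ; cp-rep      = λ i → merged-cp i (r i Fin.≟ y)
    ; negs-within = All.map (union-cong cp x y) (negs-within inv)
    ; connected   = connected-union (redirect x y) (λ _ → refl) (adj-merge x y) link (connected inv) }
    where
      x-stays : redirect x y (r x) ≡ x
      x-stays = trans (cong (redirect x y) x-vertex) (redirect-other x≢y)
      merged-idem : ∀ i → Dec (r i ≡ y) → redirect x y (r (redirect x y (r i))) ≡ redirect x y (r i)
      merged-idem i (yes iy) = trans (cong (λ w → redirect x y (r w)) (redirect-joined iy)) (trans x-stays (sym (redirect-joined iy)))
      merged-idem i (no iy)  = trans (cong (λ w → redirect x y (r w)) (redirect-other iy)) (cong (redirect x y) (rep-idem inv i))
      merged-cp : ∀ i → Dec (r i ≡ y) → union cp x y (redirect x y (r i)) ≡ union cp x y i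
      merged-cp i (yes iy) = trans (cong (union cp x y) (redirect-joined iy))
                               (trans (union-source cp x y) (sym (redirect-joined (trans (sym (cp-rep inv i)) (cong cp iy)))))
      merged-cp i (no iy)  = trans (cong (union cp x y) (redirect-other iy)) (union-cong cp x y (cp-rep inv i))
      link : Star (Adj (applyStep (mkG r ns) (mkStep x y true))) (redirect x y (r x)) (redirect x y (r y))
      link = subst₂ (Star _) (sym x-stays) (sym (redirect-joined y-vertex)) ε

  componentMap-edge : ComponentMap (applyStep (mkG r ns) (mkStep x y false)) (union cp x y)
  componentMap-edge = record
    { rep-idem    = rep-idem inv
    ; cp-idem     = union-idem cp x y (cp-idem inv)
    ; cp-rep      = λ i → union-cong cp x y (cp-rep inv i)
    ; negs-within = trans (union-source cp x y) (sym (redirect-joined {w = cp y} refl)) ∷ All.map (union-cong cp x y) (negs-within inv)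
    ; connected   = connected-union id (λ _ → refl) there (here (inj₁ (refl , refl)) ◅ ε) (connected inv) }

componentMap-step : ∀ {G : AGraph n} {cp x y} b → ValidQuery G (x , y) → ComponentMap G cp →
                    ComponentMap (applyStep G (mkStep x y b)) (union cp x y)
componentMap-step {G = mkG r ns} true  = componentMap-merge
componentMap-step {G = mkG r ns} false = componentMap-edge

module _ {G : AGraph n} {cp : Fin n → Fin n} (inv : ComponentMap G cp) where
  private
    cp-of : ∀ {a u} → rep G a ≡ u → cp u ≡ cp a
    cp-of p = trans (cong cp (sym p)) (cp-rep inv _)
    vertex-of : ∀ {a u} → rep G a ≡ u → IsVertex G u
    vertex-of p = subst (λ w → rep G w ≡ w) p (rep-idem inv _)

  adj-within : ∀ {u v} → Adj G u v → cp u ≡ cp v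
  adj-within adj with All.lookupAny (negs-within inv) adj
  ... | e , inj₁ (p , q) = trans (cp-of p) (trans e (sym (cp-of q)))
  ... | e , inj₂ (p , q) = trans (cp-of q) (trans (sym e) (sym (cp-of p)))

  adj-vertices : ∀ {u v} → Adj G u v → IsVertex G u × IsVertex G v
  adj-vertices adj with Any.satisfied adj
  ... | _ , inj₁ (p , q) = vertex-of p , vertex-of q
  ... | _ , inj₂ (p , q) = vertex-of q , vertex-of p

record Respects (c : Coloring n) (G : AGraph n) : Set where
  field
    rep-colour       : ∀ i → c (rep G i) ≡ c i
    negs-bichromatic : All (λ e → c (proj₁ e) ≢ c (proj₂ e)) (negs G)
open Respects

respects-init : ∀ (c : Coloring n) → Respects c initG
respects-init c = record { rep-colour = λ _ → refl ; negs-bichromatic = [] }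

respects-step : ∀ (c : Coloring n) (G : AGraph n) q → Respects c G → Respects c (applyStep G (stepOf c q))
respects-step c (mkG r ns) (x , y) resp with c x Bool.≟ c y
... | yes same = record { rep-colour = merged ; negs-bichromatic = negs-bichromatic resp }
  where
    merged : ∀ i → c (redirect x y (r i)) ≡ c i
    merged i with r i Fin.≟ y
    ... | yes iy = trans same (trans (cong c (sym iy)) (rep-colour resp i))
    ... | no _   = rep-colour resp i
... | no differ = record { rep-colour = rep-colour resp ; negs-bichromatic = differ ∷ negs-bichromatic resp }

module _ {c : Coloring n} {G : AGraph n} (resp : Respects c G) where
  private
    colour-of : ∀ {a u} → rep G a ≡ u → c a ≡ c u
    colour-of p = trans (sym (rep-colour resp _)) (cong c p)

  adj-bichromatic : ∀ {u v} → Adj G u v → c u ≢ c v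
  adj-bichromatic adj with All.lookupAny (negs-bichromatic resp) adj
  ... | e , inj₁ (p , q) = λ uv → e (trans (colour-of p) (trans uv (sym (colour-of q))))
  ... | e , inj₂ (p , q) = λ uv → e (trans (colour-of p) (trans (sym uv) (sym (colour-of q))))

adj? : ∀ (G : AGraph n) u v → Dec (Adj G u v)
adj? G u v = Any.any? (λ e → ((rep G (proj₁ e) Fin.≟ u) ×-dec (rep G (proj₂ e) Fin.≟ v))
                           ⊎-dec ((rep G (proj₁ e) Fin.≟ v) ×-dec (rep G (proj₂ e) Fin.≟ u))) (negs G)

isProductive : Coloring n → (Fin n → Fin n) → Fin n × Fin n → Bool
isProductive c cp (x , y) = not (answer c x y) ∧ not (does (cp x Fin.≟ cp y))

module _ {G : AGraph n} {cp : Fin n → Fin n} (inv : ComponentMap G cp) where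
  linked-within : ∀ {a l} → Linked (Adj G) (a ∷ l) → All (λ z → cp z ≡ cp a) l
  linked-within [-]         = []
  linked-within (adj ∷ lnk) = sym (adj-within inv adj) ∷ All.map (λ e → trans e (sym (adj-within inv adj))) (linked-within lnk)

  linked-vertices : ∀ {a l} → Linked (Adj G) (a ∷ l) → All (IsVertex G) l
  linked-vertices [-]         = []
  linked-vertices (adj ∷ lnk) = proj₂ (adj-vertices inv adj) ∷ linked-vertices lnk

  apart⇒¬excessive : ∀ c x y → cp x ≢ cp y → ¬ Excessive G c x y
  apart⇒¬excessive c x y x≉y (_ , (mid , refl) , _ , _ , lnk , _) =
    x≉y (sym (All.lookup (linked-within lnk) (∈-++⁺ʳ mid (here refl))))

  open InducedPaths Fin._≟_ (Adj G) (adj? G) using (IsInducedPath; inducedPath; induced⇒lookup)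
  open IsInducedPath

  joined⇒excessive : ∀ {c} → Respects c G → ∀ {x y} → IsVertex G x → IsVertex G y → x ≢ y →
                     cp x ≡ cp y → c x ≢ c y → Excessive G c x y
  joined⇒excessive {c} resp {x} {y} vx vy x≢y x≈y cx≢cy
    with inducedPath (subst₂ (Star (Adj G)) vx vy (connected inv x y x≈y))
  ... | t , p = x ∷ t , last-distinct t (endsAt p) x≢y , vx ∷ linked-vertices (linked p) , unique p , linked p
              , induced⇒lookup (x ∷ t) (induced p) , alternating , alternating-even c t alternating (endsAt p) cx≢cy
    where alternating : Linked (λ a b → c a ≢ c b) (x ∷ t)
          alternating = Linked.map (adj-bichromatic resp) (linked p)

  productive-reflects : ∀ {c} → Respects c G → ∀ {q} → ValidQuery G q → Reflects (Productive G c q) (isProductive c cp q)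
  productive-reflects {c} resp {x , y} (vx , vy , x≢y , _) with c x Bool.≟ c y | cp x Fin.≟ cp y
  ... | yes _     | _        = ofⁿ λ (not-core , _) → not-core refl
  ... | no cx≢cy  | yes x≈y  = ofⁿ λ (_ , not-exc) → not-exc (joined⇒excessive resp vx vy x≢y x≈y cx≢cy)
  ... | no cx≢cy  | no x≉y   = ofʸ ((λ ()) , apart⇒¬excessive c x y x≉y)

validQuery? : ∀ (G : AGraph n) q → Dec (ValidQuery G q)
validQuery? G (u , v) = (rep G u Fin.≟ u) ×-dec (rep G v Fin.≟ v) ×-dec ¬? (u Fin.≟ v) ×-dec ¬? (adj? G u v)

legalQueries : AGraph n → ℕ
legalQueries {n} G = ∑[ u < n ] ∑[ v < n ] bit (does (validQuery? G (u , v)))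

validQuery-step⁻ : ∀ (G : AGraph n) {x y} b → ValidQuery G (x , y) → ∀ {q} →
                   ValidQuery (applyStep G (mkStep x y b)) q → ValidQuery G q
validQuery-step⁻ (mkG r ns) {x} {y} true (vx , _ , x≢y , _) {u , v} (vu , vv , u≢v , ¬adj) =
  unmerged vu .proj₁ , unmerged vv .proj₁ , u≢v ,
  λ adj → ¬adj (subst₂ (Adj _) (redirect-other (unmerged vu .proj₂)) (redirect-other (unmerged vv .proj₂))
                  (adj-merge x y adj))
  where
    unmerged : ∀ {w} → redirect x y (r w) ≡ w → r w ≡ w × w ≢ y
    unmerged {w} e with r w Fin.≟ y
    ... | yes wy = ⊥-elim (x≢y (trans (sym vx) (trans (cong r e) wy)))
    ... | no w≢y = e , λ w≡y → w≢y (trans e w≡y)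
validQuery-step⁻ (mkG r ns) false _ (vu , vv , u≢v , ¬adj) = vu , vv , u≢v , λ adj → ¬adj (there adj)

validQuery-step-spent : ∀ (G : AGraph n) {x y} b → ValidQuery G (x , y) → ¬ ValidQuery (applyStep G (mkStep x y b)) (x , y)
validQuery-step-spent (mkG r ns) true  (_ , vy , x≢y , _) (_ , vy′ , _) = x≢y (trans (sym (redirect-joined vy)) vy′)
validQuery-step-spent (mkG r ns) false (vx , vy , _ , _)  (_ , _ , _ , ¬adj) = ¬adj (here (inj₁ (vx , vy)))

legalQueries-step : ∀ (G : AGraph n) {x y} b → ValidQuery G (x , y) → legalQueries (applyStep G (mkStep x y b)) < legalQueries G
legalQueries-step {n} G {x} {y} b vq =
  ∑-mono-< (λ u → ∑-mono (λ v → still-legal (u , v))) x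
    (∑-mono-< (λ v → still-legal (x , v)) y (bit-mono-< (validQuery? G′ (x , y)) (validQuery? G (x , y)) (validQuery-step-spent G b vq) vq))
  where
    G′ : AGraph n
    G′ = applyStep G (mkStep x y b)
    still-legal : ∀ q → bit (does (validQuery? G′ q)) ≤ bit (does (validQuery? G q))
    still-legal q = bit-mono (validQuery? G′ q) (validQuery? G q) (validQuery-step⁻ G b vq)

complete? : ∀ (G : AGraph n) → Dec (Complete G)
complete? G = all? λ u → all? λ v → (rep G u Fin.≟ u) →-dec (rep G v Fin.≟ v) →-dec ¬? (u Fin.≟ v) →-dec adj? G u v

module _ (h : History n) (s : Step n) where
  graphOf-snoc : graphOf (h ++ [ s ]) ≡ applyStep (graphOf h) s
  graphOf-snoc = foldl-++ applyStep initG h [ s ]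

  components-snoc : components (h ++ [ s ]) ≡ union (components h) (Step.qx s) (Step.qy s)
  components-snoc = foldl-++ _ id h [ s ]

module _ (h : History n) {x y : Fin n} (b : Bool) (vq : ValidQuery (graphOf h) (x , y)) where
  componentMap-snoc : ComponentMap (graphOf h) (components h) →
                      ComponentMap (graphOf (h ++ [ mkStep x y b ])) (components (h ++ [ mkStep x y b ]))
  componentMap-snoc inv = subst₂ ComponentMap (sym (graphOf-snoc h _)) (sym (components-snoc h _)) (componentMap-step b vq inv)

  legalQueries-snoc : ∀ {f} → legalQueries (graphOf h) < suc f → legalQueries (graphOf (h ++ [ mkStep x y b ])) < f
  legalQueries-snoc lt = subst (λ G → legalQueries G < _) (sym (graphOf-snoc h _)) (<-≤-trans (legalQueries-step (graphOf h) b vq) (≤-pred lt))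

respects-snoc : ∀ (c : Coloring n) h q → Respects c (graphOf h) → Respects c (graphOf (h ++ [ stepOf c q ]))
respects-snoc c h q resp = subst (Respects c) (sym (graphOf-snoc h _)) (respects-step c (graphOf h) q resp)

module Run {n : ℕ} (A : ACAlgorithm n) where
  extend : Coloring n → History n → History n
  extend c h = h ++ [ stepOf c (next A h) ]

  -- With fuel f only the first f queries of the run are counted.
  productiveCount : Coloring n → ℕ → History n → ℕ
  productiveCount c zero    h = 0
  productiveCount c (suc f) h with complete? (graphOf h)
  ... | yes _ = 0
  ... | no  _ = bit (isProductive c (components h) (next A h)) + productiveCount c f (extend c h)

  runCount-step : ∀ {c h k b} → ¬ Complete (graphOf h) → Reflects (Productive (graphOf h) c (next A h)) b →
                  RunCount A c (extend c h) k → RunCount A c h (bit b + k)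
  runCount-step incomplete (ofʸ p)  = prod incomplete p
  runCount-step incomplete (ofⁿ ¬p) = nonprod incomplete ¬p

  productiveCount-sound : ∀ c f h → ComponentMap (graphOf h) (components h) → Respects c (graphOf h) →
                          legalQueries (graphOf h) < f → RunCount A c h (productiveCount c f h)
  productiveCount-sound c (suc f) h inv resp lt with complete? (graphOf h)
  ... | yes complete  = done complete
  ... | no incomplete =
    runCount-step incomplete (productive-reflects inv resp vq)
      (productiveCount-sound c f (extend c h) (componentMap-snoc h _ vq inv) (respects-snoc c h _ resp) (legalQueries-snoc h _ vq lt))
    where vq : ValidQuery (graphOf h) (next A h)
          vq = valid A h incomplete

  productiveCount-complete : ∀ c f h → Complete (graphOf h) → productiveCount c (suc f) h ≡ 0
  productiveCount-complete c f h complete with complete? (graphOf h)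
  ... | yes _         = refl
  ... | no incomplete = ⊥-elim (incomplete complete)

  productiveCount-incomplete : ∀ c f h → ¬ Complete (graphOf h) →
    productiveCount c (suc f) h ≡ bit (isProductive c (components h) (next A h)) + productiveCount c f (extend c h)
  productiveCount-incomplete c f h incomplete with complete? (graphOf h)
  ... | yes complete = ⊥-elim (incomplete complete)
  ... | no _         = refl

  productiveCount-constant : ∀ c → ¬ NonConstant c → ∀ f h → productiveCount c f h ≡ 0
  productiveCount-constant c constant zero    h = refl
  productiveCount-constant c constant (suc f) h = by-cases (complete? (graphOf h))
    where
      by-cases : Dec (Complete (graphOf h)) → productiveCount c (suc f) h ≡ 0
      by-cases (yes complete)  = productiveCount-complete c f h complete
      by-cases (no incomplete) = trans (productiveCount-incomplete c f h incomplete)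
        (cong₂ (λ a k → bit (not a ∧ _) + k)
               (dec-true (c _ Bool.≟ c _) (decidable-stable (c _ Bool.≟ c _) λ ne → constant (_ , _ , ne)))
               (productiveCount-constant c constant f (extend c h)))

  productiveQueries : Coloring n → ℕ
  productiveQueries c = productiveCount c (suc (legalQueries (initG {n}))) []

  productiveQueries-sound : ∀ c → ProductiveCount A c (productiveQueries c)
  productiveQueries-sound c = productiveCount-sound c _ [] componentMap-init (respects-init c) (n<1+n _)

  productiveQueries-constant : ∀ c → ¬ NonConstant c → productiveQueries c ≡ 0
  productiveQueries-constant c constant = productiveCount-constant c constant _ []

-- Counting over the decision tree

agrees : Coloring n → Step n → Bool
agrees c s = does (Step.ans s Bool.≟ answer c (Step.qx s) (Step.qy s))

consistent : Coloring n → History n → Bool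
consistent c = all (agrees c)

consistent-snoc : ∀ (c : Coloring n) h s → consistent c (h ++ [ s ]) ≡ consistent c h ∧ agrees c s
consistent-snoc c []       s = Bool.∧-identityʳ _
consistent-snoc c (s′ ∷ h) s = trans (cong (agrees c s′ ∧_) (consistent-snoc c h s)) (sym (Bool.∧-assoc (agrees c s′) _ _))

consistent-ext : ∀ {c c′ : Coloring n} → (∀ i → c i ≡ c′ i) → ∀ h → consistent c h ≡ consistent c′ h
consistent-ext eq []                = refl
consistent-ext eq (mkStep x y b ∷ h) =
  cong₂ _∧_ (cong₂ (λ p q → does (b Bool.≟ does (p Bool.≟ q))) (eq x) (eq y)) (consistent-ext eq h)

answer-flipOn-within : ∀ K (c : Coloring n) {a b} → K a ≡ K b → answer (flipOn K c) a b ≡ answer c a b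
answer-flipOn-within K c {a} {b} eq with K a | K b | eq
... | false | .false | refl = refl
... | true  | .true  | refl = both-flipped (c a) (c b)
  where both-flipped : ∀ p q → does (not p Bool.≟ not q) ≡ does (p Bool.≟ q)
        both-flipped false false = refl
        both-flipped false true  = refl
        both-flipped true  false = refl
        both-flipped true  true  = refl

answer-flipOn-across : ∀ K (c : Coloring n) {a b} → K a ≡ false → K b ≡ true → answer (flipOn K c) a b ≡ not (answer c a b)
answer-flipOn-across K c {a} {b} ka kb with K a | K b | ka | kb
... | .false | .true | refl | refl = one-flipped (c a) (c b)
  where one-flipped : ∀ p q → does (p Bool.≟ not q) ≡ not (does (p Bool.≟ q))
        one-flipped false false = refl
        one-flipped false true  = refl
        one-flipped true  false = refl
        one-flipped true  true  = refl

consistent-flipOn : ∀ K (c : Coloring n) h → All (λ s → K (Step.qx s) ≡ K (Step.qy s)) h → consistent (flipOn K c) h ≡ consistent c h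
consistent-flipOn K c []                 []       = refl
consistent-flipOn K c (mkStep x y b ∷ h) (e ∷ es) =
  cong₂ _∧_ (cong (λ a → does (b Bool.≟ a)) (answer-flipOn-within K c e)) (consistent-flipOn K c h es)

componentCount : (Fin n → Fin n) → ℕ
componentCount {n} cp = ∑[ u < n ] bit (does (cp u Fin.≟ u))

componentCount-id : ∀ n → componentCount {n} id ≡ n
componentCount-id n = trans (sum-cong-≗ {n} λ u → cong bit (dec-true (u Fin.≟ u) refl)) (∑-one n)

componentCount-joined : ∀ (cp : Fin n → Fin n) {x y} → cp x ≡ cp y → componentCount (union cp x y) ≡ componentCount cp
componentCount-joined {n} cp {x} {y} x≈y = sum-cong-≗ {n} λ u → cong (λ w → bit (does (w Fin.≟ u))) (unchanged u (cp u Fin.≟ cp y))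
  where unchanged : ∀ u → Dec (cp u ≡ cp y) → union cp x y u ≡ cp u
        unchanged u (yes uy) = trans (redirect-joined uy) (trans x≈y (sym uy))
        unchanged u (no uy)  = redirect-other uy

-- Joining two components removes exactly one component representative, namely cp y.
componentCount-apart : ∀ (cp : Fin n → Fin n) → (∀ i → cp (cp i) ≡ cp i) → ∀ {x y} → cp x ≢ cp y →
                       componentCount cp ≡ suc (componentCount (union cp x y))
componentCount-apart {n} cp idem {x} {y} x≉y = begin
  componentCount cp                                              ≡⟨ sum-cong-≗ {n} (λ u → split u (u Fin.≟ cp y) (cp u Fin.≟ cp y)) ⟩
  ∑[ u < n ] (bit (does (union cp x y u Fin.≟ u)) + bit (does (u Fin.≟ cp y))) ≡⟨ ∑-+ (λ u → bit (does (union cp x y u Fin.≟ u))) (λ u → bit (does (u Fin.≟ cp y))) ⟩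
  componentCount (union cp x y) + ∑[ u < n ] bit (does (u Fin.≟ cp y))        ≡⟨ cong (componentCount (union cp x y) +_) (∑-indicator (cp y)) ⟩
  componentCount (union cp x y) + 1                              ≡⟨ +-comm _ 1 ⟩
  suc (componentCount (union cp x y))                            ∎
  where
    open ≡-Reasoning
    split : ∀ u → Dec (u ≡ cp y) → Dec (cp u ≡ cp y) →
            bit (does (cp u Fin.≟ u)) ≡ bit (does (union cp x y u Fin.≟ u)) + bit (does (u Fin.≟ cp y))
    split u (yes refl) _ = trans (cong bit (dec-true (cp u Fin.≟ u) (idem y)))
      (sym (cong₂ (λ p q → bit p + bit q) (dec-false (union cp x y u Fin.≟ u) (λ e → x≉y (trans (sym (redirect-joined (idem y))) e))) (dec-true (u Fin.≟ u) refl)))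
    split u (no u≢y) (yes uy) = trans (cong bit (dec-false (cp u Fin.≟ u) (λ e → u≢y (trans (sym e) uy))))
      (sym (cong₂ (λ p q → bit p + bit q) (dec-false (union cp x y u Fin.≟ u) x≢u) (dec-false (u Fin.≟ cp y) u≢y)))
      where x≢u : union cp x y u ≢ u
            x≢u e = x≉y (trans (sym (idem x)) (trans (cong cp (trans (sym (redirect-joined uy)) e)) uy))
    split u (no u≢y) (no uy) = trans (cong (λ w → bit (does (w Fin.≟ u))) (sym (redirect-other uy)))
      (sym (trans (cong (bit (does (union cp x y u Fin.≟ u)) +_) (cong bit (dec-false (u Fin.≟ cp y) u≢y))) (+-identityʳ _)))

componentCount-complete : ∀ {G : AGraph (suc n)} {cp} → ComponentMap G cp → Complete G → componentCount cp ≡ 1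
componentCount-complete {n} {G} {cp} inv complete =
  trans (sum-cong-≗ {suc n} λ u → bit-cong (cp u Fin.≟ u) (u Fin.≟ K) (λ e → trans (sym e) (all-K u)) (λ e → trans (all-K u) (sym e)))
        (∑-indicator K)
  where
    K : Fin (suc n)
    K = cp (rep G fzero)
    rep-K : ∀ i → Dec (rep G i ≡ rep G fzero) → cp (rep G i) ≡ K
    rep-K i (yes same) = cong cp same
    rep-K i (no apart) = adj-within inv (complete _ _ (rep-idem inv i) (rep-idem inv fzero) apart)
    all-K : ∀ i → cp i ≡ K
    all-K i = trans (sym (cp-rep inv i)) (rep-K i (rep G i Fin.≟ rep G fzero))

balance-joined : ∀ St Sf Ct Cf m → 2 * St + Ct ≡ m * Ct → 2 * Sf + Cf ≡ m * Cf →
                 2 * (St + Sf + 0) + (Ct + Cf) ≡ m * (Ct + Cf)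
balance-joined St Sf Ct Cf m eqt eqf = begin
  2 * (St + Sf + 0) + (Ct + Cf)   ≡⟨ solve 4 (λ st sf ct cf → con 2 :* (st :+ sf :+ con 0) :+ (ct :+ cf)
                                                           := (con 2 :* st :+ ct) :+ (con 2 :* sf :+ cf)) refl St Sf Ct Cf ⟩
  (2 * St + Ct) + (2 * Sf + Cf)   ≡⟨ cong₂ _+_ eqt eqf ⟩
  m * Ct + m * Cf                 ≡⟨ *-distribˡ-+ m Ct Cf ⟨
  m * (Ct + Cf)                   ∎
  where open ≡-Reasoning

balance-apart : ∀ St Sf Ct Cf m → Ct ≡ Cf → 2 * St + Ct ≡ m * Ct → 2 * Sf + Cf ≡ m * Cf →
                2 * (St + Sf + Cf) + (Ct + Cf) ≡ suc m * (Ct + Cf)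
balance-apart St Sf C .C m refl eqt eqf = begin
  2 * (St + Sf + C) + (C + C)           ≡⟨ solve 3 (λ st sf c → con 2 :* (st :+ sf :+ c) :+ (c :+ c)
                                                          := (con 2 :* st :+ c) :+ (con 2 :* sf :+ c) :+ (c :+ c)) refl St Sf C ⟩
  (2 * St + C) + (2 * Sf + C) + (C + C) ≡⟨ cong (_+ (C + C)) (cong₂ _+_ eqt eqf) ⟩
  m * C + m * C + (C + C)               ≡⟨ solve 2 (λ m c → m :* c :+ m :* c :+ (c :+ c) := (con 1 :+ m) :* (c :+ c)) refl m C ⟩
  suc m * (C + C)                       ∎
  where open ≡-Reasoning

module Counting {n : ℕ} (A : ACAlgorithm (suc n)) where
  open Run A

  consistentCount : History (suc n) → ℕ
  consistentCount h = ∑ᶜ (suc n) (λ c → bit (consistent c h))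

  productiveTotal : ℕ → History (suc n) → ℕ
  productiveTotal f h = ∑ᶜ (suc n) (λ c → when (consistent c h) (productiveCount c f h))

  Balanced : ℕ → History (suc n) → ℕ → Set
  Balanced f h m = 2 * productiveTotal f h + consistentCount h ≡ m * consistentCount h

  QueriesWithin : History (suc n) → Set
  QueriesWithin h = All (λ s → components h (Step.qx s) ≡ components h (Step.qy s)) h

  productiveTotal-complete : ∀ f h → Complete (graphOf h) → productiveTotal (suc f) h ≡ 0
  productiveTotal-complete f h complete =
    trans (total-cong (allColorings (suc n)) λ c → trans (cong (when _) (productiveCount-complete c f h complete)) (when-zero _))
          (total-zero (allColorings (suc n)))

  module Branching (h : History (suc n)) (incomplete : ¬ Complete (graphOf h)) where
    x y : Fin (suc n)
    x = proj₁ (next A h)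
    y = proj₂ (next A h)

    cp : Fin (suc n) → Fin (suc n)
    cp = components h

    crossing : Bool
    crossing = not (does (cp x Fin.≟ cp y))

    branch : Bool → History (suc n)
    branch b = h ++ [ mkStep x y b ]

    consistent-branch : ∀ c b → consistent c (branch b) ≡ consistent c h ∧ does (b Bool.≟ answer c x y)
    consistent-branch c b = consistent-snoc c h (mkStep x y b)

    components-branch : ∀ b → components (branch b) ≡ union cp x y
    components-branch b = components-snoc h (mkStep x y b)

    consistentCount-split : consistentCount h ≡ consistentCount (branch true) + consistentCount (branch false)
    consistentCount-split = trans
      (total-cong (allColorings (suc n)) λ c → trans (bit-∧-split (consistent c h) (answer c x y))
        (sym (cong₂ (λ p q → bit p + bit q) (consistent-branch c true) (consistent-branch c false))))
      (total-+ _ _ (allColorings (suc n)))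

    productiveCount-branch : ∀ f c → when (consistent c h) (productiveCount c (suc f) h)
      ≡ when (consistent c (branch true)) (productiveCount c f (branch true))
        + (when (consistent c (branch false)) (productiveCount c f (branch false)) + when (consistent c (branch false)) (bit crossing))
    productiveCount-branch f c = begin
      when (consistent c h) (productiveCount c (suc f) h)
        ≡⟨ cong (when (consistent c h)) (productiveCount-incomplete c f h incomplete) ⟩
      when (consistent c h) (bit (not (answer c x y) ∧ crossing) + productiveCount c f (branch (answer c x y)))
        ≡⟨ cong (λ k → when (consistent c h) (_ + k)) (if-same (λ b → productiveCount c f (branch b)) (answer c x y)) ⟩
      when (consistent c h) (bit (not (answer c x y) ∧ crossing)
                             + (if answer c x y then productiveCount c f (branch true) else productiveCount c f (branch false)))
        ≡⟨ when-split (consistent c h) (answer c x y) _ _ _ ⟩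
      when (consistent c h ∧ does (true Bool.≟ answer c x y)) (productiveCount c f (branch true))
        + when (consistent c h ∧ does (false Bool.≟ answer c x y)) (productiveCount c f (branch false) + bit crossing)
        ≡⟨ cong₂ (λ p q → when p (productiveCount c f (branch true)) + when q (productiveCount c f (branch false) + bit crossing))
                 (consistent-branch c true) (consistent-branch c false) ⟨
      when (consistent c (branch true)) (productiveCount c f (branch true))
        + when (consistent c (branch false)) (productiveCount c f (branch false) + bit crossing)
        ≡⟨ cong (when (consistent c (branch true)) (productiveCount c f (branch true)) +_) (when-+ (consistent c (branch false)) _ _) ⟩
      when (consistent c (branch true)) (productiveCount c f (branch true))
        + (when (consistent c (branch false)) (productiveCount c f (branch false)) + when (consistent c (branch false)) (bit crossing)) ∎
      where open ≡-Reasoning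

    productiveTotal-split : ∀ f → productiveTotal (suc f) h ≡
      productiveTotal f (branch true) + productiveTotal f (branch false) + ∑ᶜ (suc n) (λ c → when (consistent c (branch false)) (bit crossing))
    productiveTotal-split f =
      trans (total-cong (allColorings (suc n)) (productiveCount-branch f))
        (trans (total-+ _ _ (allColorings (suc n)))
          (trans (cong (productiveTotal f (branch true) +_) (total-+ _ _ (allColorings (suc n))))
            (sym (+-assoc (productiveTotal f (branch true)) _ _))))

    queriesWithin-branch : QueriesWithin h → ∀ b → QueriesWithin (branch b)
    queriesWithin-branch within b =
      subst (λ k → All (λ s → k (Step.qx s) ≡ k (Step.qy s)) (branch b)) (sym (components-branch b))
        (++⁺ (All.map (union-cong cp x y) within) (trans (union-source cp x y) (sym (redirect-joined {w = cp y} refl)) ∷ []))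

    branches-balanced : cp x ≢ cp y → QueriesWithin h → consistentCount (branch true) ≡ consistentCount (branch false)
    branches-balanced x≉y within =
      trans (∑ᶜ-flipOn (suc n) K (λ c → bit (consistent c (branch true))) (λ eq → cong bit (consistent-ext eq (branch true))))
            (total-cong (allColorings (suc n)) swapped)
      where
        K : Fin (suc n) → Bool
        K i = does (cp i Fin.≟ cp y)
        true≟not : ∀ a → does (true Bool.≟ not a) ≡ does (false Bool.≟ a)
        true≟not false = refl
        true≟not true  = refl
        swapped : ∀ c → bit (consistent (flipOn K c) (branch true)) ≡ bit (consistent c (branch false))
        swapped c = cong bit (begin
          consistent (flipOn K c) (branch true)                          ≡⟨ consistent-branch (flipOn K c) true ⟩
          consistent (flipOn K c) h ∧ does (true Bool.≟ answer (flipOn K c) x y)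
            ≡⟨ cong₂ (λ p a → p ∧ does (true Bool.≟ a))
                     (consistent-flipOn K c h (All.map (cong (λ k → does (k Fin.≟ cp y))) within))
                     (answer-flipOn-across K c (dec-false (cp x Fin.≟ cp y) x≉y) (dec-true (cp y Fin.≟ cp y) refl)) ⟩
          consistent c h ∧ does (true Bool.≟ not (answer c x y))         ≡⟨ cong (consistent c h ∧_) (true≟not (answer c x y)) ⟩
          consistent c h ∧ does (false Bool.≟ answer c x y)              ≡⟨ consistent-branch c false ⟨
          consistent c (branch false)                                     ∎)
          where open ≡-Reasoning

    module _ (f : ℕ) where
      private
        St Sf Ct Cf : ℕ
        St = productiveTotal f (branch true)
        Sf = productiveTotal f (branch false)
        Ct = consistentCount (branch true)
        Cf = consistentCount (branch false)

      balanced-joined : cp x ≡ cp y → (∀ b → Balanced f (branch b) (componentCount (union cp x y))) →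
                        Balanced (suc f) h (componentCount cp)
      balanced-joined x≈y IH = begin
        2 * productiveTotal (suc f) h + consistentCount h ≡⟨ cong₂ (λ s c → 2 * s + c) (productiveTotal-split f) consistentCount-split ⟩
        2 * (St + Sf + ∑ᶜ (suc n) (λ c → when (consistent c (branch false)) (bit crossing))) + (Ct + Cf)
                                                          ≡⟨ cong (λ e → 2 * (St + Sf + e) + (Ct + Cf)) no-crossing ⟩
        2 * (St + Sf + 0) + (Ct + Cf)                     ≡⟨ balance-joined St Sf Ct Cf (componentCount cp) (unchanged true) (unchanged false) ⟩
        componentCount cp * (Ct + Cf)                     ≡⟨ cong (componentCount cp *_) consistentCount-split ⟨
        componentCount cp * consistentCount h             ∎
        where
          open ≡-Reasoning
          unchanged : ∀ b → Balanced f (branch b) (componentCount cp)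
          unchanged b = trans (IH b) (cong (_* consistentCount (branch b)) (componentCount-joined cp x≈y))
          no-crossing : ∑ᶜ (suc n) (λ c → when (consistent c (branch false)) (bit crossing)) ≡ 0
          no-crossing = trans (total-cong (allColorings (suc n)) λ c →
                                trans (cong (λ d → when (consistent c (branch false)) (bit (not d))) (dec-true (cp x Fin.≟ cp y) x≈y)) (when-zero _))
                              (total-zero (allColorings (suc n)))

      balanced-apart : ComponentMap (graphOf h) cp → QueriesWithin h → cp x ≢ cp y →
                       (∀ b → Balanced f (branch b) (componentCount (union cp x y))) → Balanced (suc f) h (componentCount cp)
      balanced-apart inv within x≉y IH = begin
        2 * productiveTotal (suc f) h + consistentCount h ≡⟨ cong₂ (λ s c → 2 * s + c) (productiveTotal-split f) consistentCount-split ⟩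
        2 * (St + Sf + ∑ᶜ (suc n) (λ c → when (consistent c (branch false)) (bit crossing))) + (Ct + Cf)
                                                          ≡⟨ cong (λ e → 2 * (St + Sf + e) + (Ct + Cf)) all-crossing ⟩
        2 * (St + Sf + Cf) + (Ct + Cf)                    ≡⟨ balance-apart St Sf Ct Cf (componentCount (union cp x y)) (branches-balanced x≉y within) (IH true) (IH false) ⟩
        suc (componentCount (union cp x y)) * (Ct + Cf)   ≡⟨ cong₂ _*_ (componentCount-apart cp (cp-idem inv) x≉y) consistentCount-split ⟨
        componentCount cp * consistentCount h             ∎
        where
          open ≡-Reasoning
          all-crossing : ∑ᶜ (suc n) (λ c → when (consistent c (branch false)) (bit crossing)) ≡ Cf
          all-crossing = total-cong (allColorings (suc n)) λ c →
                           cong (λ d → when (consistent c (branch false)) (bit (not d))) (dec-false (cp x Fin.≟ cp y) x≉y)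

  balanced : ∀ f h → ComponentMap (graphOf h) (components h) → QueriesWithin h → legalQueries (graphOf h) < f →
             Balanced f h (componentCount (components h))
  balanced (suc f) h inv within lt = by-cases (complete? (graphOf h))
    where
      by-cases : Dec (Complete (graphOf h)) → Balanced (suc f) h (componentCount (components h))
      by-cases (yes complete) = trans (cong (λ s → 2 * s + consistentCount h) (productiveTotal-complete f h complete))
        (sym (trans (cong (_* consistentCount h) (componentCount-complete inv complete)) (+-identityʳ (consistentCount h))))
      by-cases (no incomplete) = by-crossing (cp x Fin.≟ cp y)
        where
          open Branching h incomplete
          vq : ValidQuery (graphOf h) (x , y)
          vq = valid A h incomplete
          IH : ∀ b → Balanced f (branch b) (componentCount (union cp x y))
          IH b = subst (λ k → Balanced f (branch b) (componentCount k)) (components-branch b)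
                   (balanced f (branch b) (componentMap-snoc h b vq inv) (queriesWithin-branch within b) (legalQueries-snoc h b vq lt))
          by-crossing : Dec (cp x ≡ cp y) → Balanced (suc f) h (componentCount cp)
          by-crossing (yes x≈y) = balanced-joined f x≈y IH
          by-crossing (no x≉y)  = balanced-apart f inv within x≉y IH

  ∑ᶜ-productiveQueries : 2 * ∑ᶜ (suc n) productiveQueries ≡ n * 2 ^ suc n
  ∑ᶜ-productiveQueries = +-cancelˡ-≡ (2 ^ suc n) _ _ (trans (+-comm (2 ^ suc n) _)
    (subst₂ (λ m C → 2 * ∑ᶜ (suc n) productiveQueries + C ≡ m * C) (componentCount-id (suc n)) (∑ᶜ-one (suc n))
            (balanced _ [] componentMap-init [] (n<1+n _))))

scale-halves : ∀ T S X m → 2 * S ≡ m * X → 2 * T * S ≡ T * X * m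
scale-halves T S X m twice = begin
  2 * T * S   ≡⟨ solve 2 (λ t s → con 2 :* t :* s := t :* (con 2 :* s)) refl T S ⟩
  T * (2 * S) ≡⟨ cong (T *_) twice ⟩
  T * (m * X) ≡⟨ solve 3 (λ t m x → t :* (m :* x) := t :* x :* m) refl T m X ⟩
  T * X * m   ∎
  where open ≡-Reasoning

lemma8 : (n : ℕ) → 2 ≤ n → (A : ACAlgorithm n) →
    Σ (Coloring n → ℕ) (λ k →
      ((c : Coloring n) → NonConstant c → ProductiveCount A c (k c))
      × (2 * (2 ^ n ∸ 2) * sum (map k (twoBlockColorings n))
          ≡ length (twoBlockColorings n) * 2 ^ n * (n ∸ 1)))
lemma8 (suc n) (s≤s _) A = productiveQueries , (λ c _ → productiveQueries-sound c) , (begin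
  2 * (2 ^ suc n ∸ 2) * sum (map productiveQueries (twoBlockColorings (suc n)))
    ≡⟨ cong (2 * (2 ^ suc n ∸ 2) *_) (sum-twoBlockColorings (suc n) productiveQueries productiveQueries-constant) ⟩
  2 * (2 ^ suc n ∸ 2) * ∑ᶜ (suc n) productiveQueries
    ≡⟨ scale-halves (2 ^ suc n ∸ 2) _ (2 ^ suc n) n ∑ᶜ-productiveQueries ⟩
  (2 ^ suc n ∸ 2) * 2 ^ suc n * n
    ≡⟨ cong (λ t → t * 2 ^ suc n * n) (twoBlockColorings-length n) ⟨
  length (twoBlockColorings (suc n)) * 2 ^ suc n * n ∎)
  where
    open Run A
    open Counting A
    open ≡-Reasoning
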